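{- (I) Let $\mathcal{U}_g=\mathbb{Q}\langle b_j\mid j\ge1\rangle\otimes_{\mathbb{Q}}\mathbb{Q}[\tau]$ with $\deg b_j=j$, $\deg\tau=1$, and $G_g=\{1,\sigma\}$ acting on $\mathcal{U}_g^{(k)}\otimes_{\mathbb{Q}}\mathbb{Q}(\sqrt{ -1})$ diagonally, where $\sigma$ is complex conjugation on $\mathbb{Q}(\sqrt{ -1})$ and acts on $\mathcal{U}_g$ as the algebra automorphism with $\sigma(b_j)=(-1)^{j+1}b_j$, $\sigma(\tau)=-\tau$. Then $$\left(\mathcal{U}_g^{(k)}\otimes\mathbb{Q}(\sqrt{ -1})\right)^{G_g}=\bigoplus_{\substack{r\ge0\\ k-r\ \mathrm{even}}}\mathrm{Span}_{\mathbb{Q}}\{b_{j_1}\cdots b_{j_r}\tau^l\otimes1\}\ \oplus\bigoplus_{\substack{r\ge0\\ k-r\ \mathrm{odd}}}\mathrm{Span}_{\mathbb{Q}}\{b_{j_1}\cdots b_{j_r}\tau^l\otimes\sqrt{ -1}\},$$ where in each span $j_1,\dots,j_r\ge1$, $l\ge0$, $\sum_i j_i+l=k$. In particular its $\mathbb{Q}$-dimension is $D_g^{(k)}$ with $\sum_k D_g^{(k)}t^k=\frac{1}{1-2t}$. (II) Let $\mathcal{U}_h=\mathbb{Q}\langle b_1^{(1)},b_1^{(2)},b_j^{(1)}\ (j\ge2)\rangle\otimes\mathbb{Q}[\tau]$ with $\deg b_j^{(s)}=j$, $\deg\tau=1$, and $G_h=\{1,\sigma\}$ acting on $\mathcal{U}_h^{(k)}\otimes\mathbb{Q}(\sqrt{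 -3})$ diagonally, where $\sigma(\sqrt{ -3})=-\sqrt{ -3}$ and $\sigma$ acts on $\mathcal{U}_h$ as the algebra automorphism with $\sigma(b_j^{(1)})=(-1)^{j+1}b_j^{(1)}$, $\sigma(b_1^{(2)})=b_1^{(2)}$, $\sigma(\tau)=-\tau$. Then $$\left(\mathcal{U}_h^{(k)}\otimes\mathbb{Q}(\sqrt{ -3})\right)^{G_h}=\bigoplus_{\substack{r\ge0\\ k-r\ \mathrm{even}}}\mathrm{Span}_{\mathbb{Q}}\{b^{(s_1)}_{j_1}\cdots b^{(s_r)}_{j_r}\tau^l\otimes1\}\ \oplus\bigoplus_{\substack{r\ge0\\ k-r\ \mathrm{odd}}}\mathrm{Span}_{\mathbb{Q}}\{b^{(s_1)}_{j_1}\cdots b^{(s_r)}_{j_r}\tau^l\otimes\sqrt{ -3}\},$$ where in each span $j_i\ge1$, $s_i\in\{1,2\}$ if $j_i=1$ and $s_i=1$ if $j_i>1$, $l\ge0$, $\sum_i j_i+l=k$. In particular its $\mathbb{Q}$-dimension is $D_h^{(k)}$ with $\sum_k D_h^{(k)}t^k=\frac{1}{1-3t+t^2}$.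
   Context: $\mathbb{Q}\langle\cdot\rangle$ denotes the free non-commutative polynomial algebra over $\mathbb{Q}$ on the given generators; the superscript $(k)$ denotes the degree-$k$ homogeneous part. In the paper $\mathcal{U}_g,\mathcal{U}_h$ are identified with $\mathcal{H}_{F_g,R_g}$ and $\mathcal{H}_{F_h,R_h}$ (the motivic period algebras for $\mathbb{Q}(\xi_4)$ unramified outside $2$ and $\mathbb{Q}(\xi_6)$ unramified outside $2,3$) via normalized isomorphisms, and the Galois actions above are the transported actions. -}

module Defs where

open import Data.Nat as ℕ using (ℕ; zero; suc; _+_; _∸_)
open import Data.Integer as ℤ using (ℤ)
open import Data.Rational as ℚ using (ℚ; 0ℚ; 1ℚ)
open import Data.Product using (Σ; ∃; _×_; _,_; proj₁; proj₂)
open import Data.List using (List; []; _∷_; length)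
open import Data.Bool using (Bool; true; false; if_then_else_)
open import Relation.Binary.PropositionalEquality using (_≡_)
open import Data.Fin using (Fin)
open import Function.Bundles using (_↔_; _⇔_)

-- Generic setting: a free non-commutative algebra Q⟨G⟩ on a set of
-- graded generators G, tensored with Q[τ] (deg τ = 1).
-- Its Q-basis consists of monomials  g₁⋯g_r τ^l  (word, l).

record Mono (G : Set) : Set where
  constructor _·τ^_
  field
    word : List G
    tpow : ℕ
open Mono public

wordDeg : {G : Set} → (G → ℕ) → List G → ℕ
wordDeg d [] = 0
wordDeg d (g ∷ gs) = d g + wordDeg d gs

deg : {G : Set} → (G → ℕ) → Mono G → ℕ
deg d m = wordDeg d (word m) + tpow m

MonoK : {G : Set} → (G → ℕ) → ℕ → Set
MonoK {G} d k = Σ (Mono G) (λ m → deg d m ≡ k)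

-- the quadratic field Q(√-d), element a + b √-d represented by (a , b)
K : Set
K = ℚ × ℚ

conj : K → K
conj (a , b) = (a , ℚ.- b)

-- U^(k) ⊗_Q Q(√-d)  =  ⊕_{m monomial of degree k} m ⊗ Q(√-d):
-- an element is its family of coefficients (the degree-k basis is finite)
V : {G : Set} → (G → ℕ) → ℕ → Set
V d k = MonoK d k → K

neg1^ : ℕ → ℚ
neg1^ zero = 1ℚ
neg1^ (suc n) = ℚ.- neg1^ n

-- σ acts on generators by signs sg; σ(τ) = -τ; extended multiplicatively
wordSign : {G : Set} → (G → ℚ) → List G → ℚ
wordSign sg [] = 1ℚ
wordSign sg (g ∷ gs) = sg g ℚ.* wordSign sg gs

monoSign : {G : Set} → (G → ℚ) → Mono G → ℚ
monoSign sg m = wordSign sg (word m) ℚ.* neg1^ (tpow m)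

scaleK : ℚ → K → K
scaleK c (a , b) = (c ℚ.* a , c ℚ.* b)

σ-act : {G : Set} {d : G → ℕ} {k : ℕ} → (G → ℚ) → V d k → V d k
σ-act sg v m = scaleK (monoSign sg (proj₁ m)) (conj (v m))

Invariant : {G : Set} {d : G → ℕ} {k : ℕ} → (G → ℚ) → V d k → Set
Invariant sg v = ∀ m → σ-act sg v m ≡ v m

even : ℕ → Bool
even zero = true
even (suc zero) = false
even (suc (suc n)) = even n

unitK : {G : Set} {d : G → ℕ} (k : ℕ) → MonoK d k → K
unitK k m = if even (k ∸ length (word (proj₁ m))) then (1ℚ , 0ℚ) else (0ℚ , 1ℚ)

-- Q-linear combination  Σ_m c_m (m ⊗ unitK m)  written coordinatewise
-- (the vectors m ⊗ unitK m have disjoint supports)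
comb : {G : Set} {d : G → ℕ} {k : ℕ} → (MonoK d k → ℚ) → V d k
comb {k = k} c m = scaleK (c m) (unitK k m)

InSpan : {G : Set} {d : G → ℕ} {k : ℕ} → V d k → Set
InSpan {d = d} {k} v = ∃ λ (c : MonoK d k → ℚ) → ∀ m → v m ≡ comb c m

Independent : {G : Set} (d : G → ℕ) (k : ℕ) → Set
Independent d k = ∀ (c c' : MonoK d k → ℚ) →
  (∀ m → comb c m ≡ comb c' m) → ∀ m → c m ≡ c' m

-- Generating functions: Σ_k D_k t^k = 1 / p(t), i.e. p(t)·Σ D_k t^k = 1,
-- p given by its coefficient list.

conv : List ℤ → (ℕ → ℕ) → ℕ → ℤ
conv [] D k = ℤ.+ 0
conv (p ∷ ps) D zero = p ℤ.* ℤ.+ (D zero)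
conv (p ∷ ps) D (suc k) = p ℤ.* ℤ.+ (D (suc k)) ℤ.+ conv ps D k

δ₀ : ℕ → ℤ
δ₀ zero = ℤ.+ 1
δ₀ (suc k) = ℤ.+ 0

GenFunInv : List ℤ → (ℕ → ℕ) → Set
GenFunInv p D = ∀ k → conv p D k ≡ δ₀ k

Claim : (G : Set) → (G → ℕ) → (G → ℚ) → List ℤ → Set
Claim G d sg p =
  ∀ (D : ℕ → ℕ) → GenFunInv p D → ∀ (k : ℕ) →
    (∀ (v : V d k) → Invariant sg v ⇔ InSpan v)
    × Independent d k
    × (Fin (D k) ↔ MonoK d k)

-- (I)  generators b_j, j ≥ 1 : GenG = ℕ, n ↦ b_{n+1}
GenG : Set
GenG = ℕ

degG : GenG → ℕ
degG n = suc n

sgG : GenG → ℚ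
sgG n = neg1^ (suc n + 1)

polyG : List ℤ
polyG = ℤ.+ 1 ∷ ℤ.- (ℤ.+ 2) ∷ []

data GenH : Set where
  b₁⁽¹⁾ : GenH
  b₁⁽²⁾ : GenH
  b⁽¹⁾ : ℕ → GenH   -- b⁽¹⁾ n = b^(1)_{n+2}

degH : GenH → ℕ
degH b₁⁽¹⁾ = 1
degH b₁⁽²⁾ = 1
degH (b⁽¹⁾ n) = n + 2

sgH : GenH → ℚ
sgH b₁⁽¹⁾ = neg1^ (1 + 1)
sgH b₁⁽²⁾ = 1ℚ
sgH (b⁽¹⁾ n) = neg1^ ((n + 2) + 1)

polyH : List ℤ
polyH = ℤ.+ 1 ∷ ℤ.- (ℤ.+ 3) ∷ ℤ.+ 1 ∷ []

{-# OPTIONS --safe #-}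
module Submission where

-- Every generator has sign (-1)^(deg + 1) under σ, so σ multiplies a monomial of degree k
-- with r letters by (-1)^(k - r).  Since σ conjugates the coefficient, an invariant vector has
-- real coefficients where k - r is even and purely imaginary ones where it is odd, and
-- conversely; this is the decomposition, and the monomials form a basis of it.
-- For the dimension, p(0) = 1 makes 1/p(t) have a unique power series expansion, so it
-- suffices to count monomials.  Splitting off the power of τ gives M(k+1) ≅ M(k) ⊎ W(k+1)
-- (M monomials, W words), and splitting off the first letter gives W(k+1) ≅ M(k) in (I) and
-- W(k+1) ≅ W(k) ⊎ M(k) in (II); hence 2^k in (I), and in (II) counts satisfying
-- m(k+2) = 3 m(k+1) - m(k).

open import Defs
open import Data.Nat as ℕ using (ℕ; zero; suc; _+_; _∸_; _^_; _≤_; _<_; z≤n; s≤s)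
import Data.Nat.Properties as ℕP
open import Data.Integer as ℤ using (ℤ)
import Data.Integer.Properties as ℤP
import Data.Integer.Solver as ℤSolver
import Data.Nat.Solver as ℕSolver
open import Data.Rational as ℚ using (ℚ; 0ℚ; 1ℚ)
import Data.Rational.Properties as ℚP
open import Data.Bool using (Bool; true; false; if_then_else_)
open import Data.Empty using (⊥-elim)
open import Data.Fin using (Fin)
open import Data.Fin.Properties using (+↔⊎)
open import Data.List using (List; []; _∷_; length)
open import Data.Product using (Σ; ∃; _×_; _,_; proj₁; proj₂)
open import Data.Sum using (_⊎_; inj₁; inj₂)
open import Data.Sum.Function.Propositional using (_⊎-↔_)
open import Function.Bundles using (_↔_; _⇔_; mk⇔; mk↔ₛ′; Equivalence)
open import Function.Properties.Inverse using (↔-sym; ↔-trans)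
open import Relation.Binary.Definitions using (tri<; tri≈; tri>)
open import Relation.Binary.PropositionalEquality
open import Algebra.Properties.Ring ℚP.+-*-ring using (-‿involutive; -1*x≈-x)
open import Algebra.Properties.AbelianGroup ℤP.+-0-abelianGroup using (∙-cancelʳ)

signOf : Bool → ℚ
signOf b = if b then 1ℚ else ℚ.- 1ℚ

unitOf : Bool → K
unitOf b = if b then (1ℚ , 0ℚ) else (0ℚ , 1ℚ)

neg1^-+ : ∀ a b → neg1^ (a + b) ≡ neg1^ a ℚ.* neg1^ b
neg1^-+ zero    b = sym (ℚP.*-identityˡ _)
neg1^-+ (suc a) b = trans (cong ℚ.-_ (neg1^-+ a b)) (ℚP.neg-distribˡ-* (neg1^ a) (neg1^ b))

neg1^≡signOf-even : ∀ n → neg1^ n ≡ signOf (even n)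
neg1^≡signOf-even zero          = refl
neg1^≡signOf-even (suc zero)    = refl
neg1^≡signOf-even (suc (suc n)) = trans (-‿involutive (neg1^ n)) (neg1^≡signOf-even n)

even-+-double : ∀ r x → even ((r + r) + x) ≡ even x
even-+-double zero    x = refl
even-+-double (suc r) x rewrite ℕP.+-suc r r = even-+-double r x

-p≡p⇒p≡0 : ∀ p → ℚ.- p ≡ p → p ≡ 0ℚ
-p≡p⇒p≡0 p -p≡p with ℚP.<-cmp p 0ℚ
... | tri≈ _ p≡0 _ = p≡0
... | tri< p<0 _ _ = ⊥-elim (ℚP.<-asym p<0 (subst (0ℚ ℚ.<_) -p≡p (ℚP.neg-antimono-< p<0)))
... | tri> _ _ p>0 = ⊥-elim (ℚP.<-asym p>0 (subst (ℚ._< 0ℚ) -p≡p (ℚP.neg-antimono-< p>0)))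

conj-eigen⇔ : ∀ b (z : K) → scaleK (signOf b) (conj z) ≡ z ⇔ ∃ λ c → z ≡ scaleK c (unitOf b)
conj-eigen⇔ true (x , y) = mk⇔ to from
  where
  to : (1ℚ ℚ.* x , 1ℚ ℚ.* ℚ.- y) ≡ (x , y) → ∃ λ c → (x , y) ≡ (c ℚ.* 1ℚ , c ℚ.* 0ℚ)
  to eq = x , cong₂ _,_ (sym (ℚP.*-identityʳ x))
    (trans (-p≡p⇒p≡0 y (trans (sym (ℚP.*-identityˡ (ℚ.- y))) (cong proj₂ eq))) (sym (ℚP.*-zeroʳ x)))
  from : (∃ λ c → (x , y) ≡ (c ℚ.* 1ℚ , c ℚ.* 0ℚ)) → (1ℚ ℚ.* x , 1ℚ ℚ.* ℚ.- y) ≡ (x , y)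
  from (c , refl) rewrite ℚP.*-zeroʳ c = cong₂ _,_ (ℚP.*-identityˡ _) refl
conj-eigen⇔ false (x , y) = mk⇔ to from
  where
  to : (ℚ.- 1ℚ ℚ.* x , ℚ.- 1ℚ ℚ.* ℚ.- y) ≡ (x , y) → ∃ λ c → (x , y) ≡ (c ℚ.* 0ℚ , c ℚ.* 1ℚ)
  to eq = y , cong₂ _,_
    (trans (-p≡p⇒p≡0 x (trans (sym (-1*x≈-x x)) (cong proj₁ eq))) (sym (ℚP.*-zeroʳ y)))
    (sym (ℚP.*-identityʳ y))
  from : (∃ λ c → (x , y) ≡ (c ℚ.* 0ℚ , c ℚ.* 1ℚ)) → (ℚ.- 1ℚ ℚ.* x , ℚ.- 1ℚ ℚ.* ℚ.- y) ≡ (x , y)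
  from (c , refl) rewrite ℚP.*-zeroʳ c | ℚP.*-identityʳ c =
    cong₂ _,_ refl (trans (-1*x≈-x (ℚ.- c)) (-‿involutive c))

scaleK-unitOf-injective : ∀ b {c c'} → scaleK c (unitOf b) ≡ scaleK c' (unitOf b) → c ≡ c'
scaleK-unitOf-injective true  {c} {c'} eq =
  trans (sym (ℚP.*-identityʳ c)) (trans (cong proj₁ eq) (ℚP.*-identityʳ c'))
scaleK-unitOf-injective false {c} {c'} eq =
  trans (sym (ℚP.*-identityʳ c)) (trans (cong proj₂ eq) (ℚP.*-identityʳ c'))

independent : ∀ {G : Set} (d : G → ℕ) k → Independent d k
independent d k c c' eq m = scaleK-unitOf-injective (even (k ∸ length (word (proj₁ m)))) (eq m)

length≤wordDeg : ∀ {G : Set} {d : G → ℕ} → (∀ g → 0 < d g) → ∀ w → length w ≤ wordDeg d w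
length≤wordDeg d-pos []      = z≤n
length≤wordDeg d-pos (g ∷ w) = ℕP.+-mono-≤ (d-pos g) (length≤wordDeg d-pos w)

module SignByParity {G : Set} {d : G → ℕ} {sg : G → ℚ}
  (d-pos : ∀ g → 0 < d g) (sg≡neg1^ : ∀ g → sg g ≡ neg1^ (d g + 1)) where

  wordSign≡neg1^ : ∀ w → wordSign sg w ≡ neg1^ (wordDeg d w + length w)
  wordSign≡neg1^ []      = refl
  wordSign≡neg1^ (g ∷ w) = begin
    sg g ℚ.* wordSign sg w
      ≡⟨ cong₂ ℚ._*_ (sg≡neg1^ g) (wordSign≡neg1^ w) ⟩
    neg1^ (d g + 1) ℚ.* neg1^ (wordDeg d w + length w)
      ≡⟨ sym (neg1^-+ (d g + 1) _) ⟩
    neg1^ ((d g + 1) + (wordDeg d w + length w))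
      ≡⟨ cong neg1^ (solve 3 (λ a b c → (a :+ con 1) :+ (b :+ c) := (a :+ b) :+ (con 1 :+ c))
                        refl (d g) (wordDeg d w) (length w)) ⟩
    neg1^ ((d g + wordDeg d w) + suc (length w)) ∎
    where open ≡-Reasoning
          open ℕSolver.+-*-Solver

  monoSign≡signOf : ∀ {k} (m : MonoK d k) →
    monoSign sg (proj₁ m) ≡ signOf (even (k ∸ length (word (proj₁ m))))
  monoSign≡signOf {k} ((w ·τ^ l) , deg≡k) = begin
    wordSign sg w ℚ.* neg1^ l           ≡⟨ cong (ℚ._* neg1^ l) (wordSign≡neg1^ w) ⟩
    neg1^ (wd + r) ℚ.* neg1^ l          ≡⟨ sym (neg1^-+ (wd + r) l) ⟩
    neg1^ ((wd + r) + l)                ≡⟨ cong neg1^ exponent ⟩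
    neg1^ ((r + r) + (k ∸ r))           ≡⟨ neg1^≡signOf-even ((r + r) + (k ∸ r)) ⟩
    signOf (even ((r + r) + (k ∸ r)))   ≡⟨ cong signOf (even-+-double r (k ∸ r)) ⟩
    signOf (even (k ∸ r))               ∎
    where
    open ≡-Reasoning
    wd = wordDeg d w
    r  = length w
    r≤k : r ≤ k
    r≤k = subst (r ≤_) deg≡k (ℕP.≤-trans (length≤wordDeg d-pos w) (ℕP.m≤m+n wd l))
    exponent : (wd + r) + l ≡ (r + r) + (k ∸ r)
    exponent = begin
      (wd + r) + l        ≡⟨ cong (_+ l) (ℕP.+-comm wd r) ⟩
      (r + wd) + l        ≡⟨ ℕP.+-assoc r wd l ⟩
      r + (wd + l)        ≡⟨ cong (r +_) deg≡k ⟩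
      r + k               ≡⟨ cong (r +_) (sym (ℕP.m+[n∸m]≡n r≤k)) ⟩
      r + (r + (k ∸ r))   ≡⟨ sym (ℕP.+-assoc r r (k ∸ r)) ⟩
      (r + r) + (k ∸ r)   ∎

  invariant⇔inSpan : ∀ {k} (v : V d k) → Invariant sg v ⇔ InSpan v
  invariant⇔inSpan {k} v = mk⇔
    (λ inv → (λ m → proj₁ (to (fixed⇔ m) (inv m))) , (λ m → proj₂ (to (fixed⇔ m) (inv m))))
    (λ (c , eq) m → from (fixed⇔ m) (c m , eq m))
    where
    open Equivalence
    fixed⇔ : ∀ m → σ-act sg v m ≡ v m ⇔ ∃ λ c → v m ≡ scaleK c (unitK k m)
    fixed⇔ m = subst (λ s → scaleK s (conj (v m)) ≡ v m ⇔ ∃ λ c → v m ≡ scaleK c (unitK k m))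
      (sym (monoSign≡signOf m)) (conj-eigen⇔ (even (k ∸ length (word (proj₁ m)))) (v m))

WordK : {G : Set} → (G → ℕ) → ℕ → Set
WordK {G} d k = Σ (List G) (λ w → wordDeg d w ≡ k)

≡-from-proj₁ : ∀ {A : Set} {f : A → ℕ} {k} {x y : Σ A (λ a → f a ≡ k)} → proj₁ x ≡ proj₁ y → x ≡ y
≡-from-proj₁ {x = a , p} {.a , q} refl = cong (a ,_) (ℕP.≡-irrelevant p q)

↔Fin-+ : ∀ {A B C : Set} {m n} → A ↔ (B ⊎ C) → B ↔ Fin m → C ↔ Fin n → A ↔ Fin (m + n)
↔Fin-+ split f g = ↔-trans split (↔-trans (f ⊎-↔ g) (↔-sym +↔⊎))

module _ {G : Set} {d : G → ℕ} where

  MonoK-suc↔ : ∀ k → MonoK d (suc k) ↔ (MonoK d k ⊎ WordK d (suc k))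
  MonoK-suc↔ k = mk↔ₛ′ to from to∘from from∘to
    where
    to : MonoK d (suc k) → MonoK d k ⊎ WordK d (suc k)
    to ((w ·τ^ suc l) , p) = inj₁ ((w ·τ^ l) , ℕP.suc-injective (trans (sym (ℕP.+-suc _ l)) p))
    to ((w ·τ^ zero)  , p) = inj₂ (w , trans (sym (ℕP.+-identityʳ _)) p)
    from : MonoK d k ⊎ WordK d (suc k) → MonoK d (suc k)
    from (inj₁ ((w ·τ^ l) , q)) = (w ·τ^ suc l) , trans (ℕP.+-suc _ l) (cong suc q)
    from (inj₂ (w , q))         = (w ·τ^ zero) , trans (ℕP.+-identityʳ _) q
    to∘from : ∀ x → to (from x) ≡ x
    to∘from (inj₁ _) = cong inj₁ (≡-from-proj₁ refl)
    to∘from (inj₂ _) = cong inj₂ (≡-from-proj₁ refl)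
    from∘to : ∀ x → from (to x) ≡ x
    from∘to ((_ ·τ^ suc _) , _) = ≡-from-proj₁ refl
    from∘to ((_ ·τ^ zero)  , _) = ≡-from-proj₁ refl

  MonoK-zero↔WordK : MonoK d 0 ↔ WordK d 0
  MonoK-zero↔WordK = mk↔ₛ′ to from (λ _ → ≡-from-proj₁ refl) from∘to
    where
    to : MonoK d 0 → WordK d 0
    to ((w ·τ^ l) , p) = w , ℕP.m+n≡0⇒m≡0 _ p
    from : WordK d 0 → MonoK d 0
    from (w , q) = (w ·τ^ 0) , trans (ℕP.+-identityʳ _) q
    from∘to : ∀ x → from (to x) ≡ x
    from∘to ((w ·τ^ l) , p) = ≡-from-proj₁ (cong (w ·τ^_) (sym (ℕP.m+n≡0⇒n≡0 _ p)))

  WordK-zero↔ : (∀ g → 0 < d g) → WordK d 0 ↔ Fin 1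
  WordK-zero↔ d-pos = mk↔ₛ′ (λ _ → Fin.zero) (λ _ → [] , refl) to∘from from∘to
    where
    to∘from : ∀ i → Fin.zero ≡ i
    to∘from Fin.zero    = refl
    to∘from (Fin.suc ())
    from∘to : ∀ x → ([] , refl) ≡ x
    from∘to ([]    , _) = ≡-from-proj₁ refl
    from∘to (g ∷ _ , p) = ⊥-elim (ℕP.<⇒≢ (d-pos g) (sym (ℕP.m+n≡0⇒m≡0 _ p)))

conv-singleton : ∀ p D k → conv (p ∷ []) D k ≡ p ℤ.* ℤ.+ D k
conv-singleton p D zero    = refl
conv-singleton p D (suc k) = ℤP.+-identityʳ _

conv-cong : ∀ ps {D D' : ℕ → ℕ} k → (∀ {i} → i ≤ k → D i ≡ D' i) → conv ps D k ≡ conv ps D' k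
conv-cong []       k       eq = refl
conv-cong (p ∷ ps) zero    eq = cong (λ n → p ℤ.* ℤ.+ n) (eq z≤n)
conv-cong (p ∷ ps) (suc k) eq =
  cong₂ (λ n z → p ℤ.* ℤ.+ n ℤ.+ z) (eq ℕP.≤-refl) (conv-cong ps k (λ i≤k → eq (ℕP.m≤n⇒m≤1+n i≤k)))

genFunInv-unique : ∀ {ps D D'} → GenFunInv (ℤ.+ 1 ∷ ps) D → GenFunInv (ℤ.+ 1 ∷ ps) D' → ∀ k → D k ≡ D' k
genFunInv-unique {ps} {D} {D'} gf gf' k = agree k ℕP.≤-refl
  where
  leading : ∀ {a b : ℕ} {x y : ℤ} → ℤ.+ 1 ℤ.* ℤ.+ a ℤ.+ x ≡ ℤ.+ 1 ℤ.* ℤ.+ b ℤ.+ y → x ≡ y → a ≡ b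
  leading {x = x} eq refl = ℤP.+-injective (trans (sym (ℤP.*-identityˡ _))
    (trans (∙-cancelʳ x _ _ eq) (ℤP.*-identityˡ _)))
  agree : ∀ k {i} → i ≤ k → D i ≡ D' i
  agree zero    z≤n = ℤP.+-injective (trans (sym (ℤP.*-identityˡ _))
    (trans (trans (gf 0) (sym (gf' 0))) (ℤP.*-identityˡ _)))
  agree (suc k) i≤1+k with ℕP.m≤n⇒m<n∨m≡n i≤1+k
  ... | inj₁ i<1+k = agree k (ℕP.≤-pred i<1+k)
  ... | inj₂ refl  = leading (trans (gf (suc k)) (sym (gf' (suc k)))) (conv-cong ps k (agree k))

claim-by-counting : ∀ {G : Set} {d : G → ℕ} {sg : G → ℚ} {ps : List ℤ} (N : ℕ → ℕ) →
  (∀ g → 0 < d g) → (∀ g → sg g ≡ neg1^ (d g + 1)) →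
  GenFunInv (ℤ.+ 1 ∷ ps) N → (∀ k → MonoK d k ↔ Fin (N k)) → Claim G d sg (ℤ.+ 1 ∷ ps)
claim-by-counting {d = d} N d-pos sg≡neg1^ N-inv count D D-inv k =
    invariant⇔inSpan
  , independent d k
  , subst (λ n → Fin n ↔ MonoK d k) (sym (genFunInv-unique D-inv N-inv k)) (↔-sym (count k))
  where open SignByParity d-pos sg≡neg1^

-- b_j w ↦ w τ^(j-1)
WordK-G-suc↔ : ∀ k → WordK degG (suc k) ↔ MonoK degG k
WordK-G-suc↔ k = mk↔ₛ′ to from (λ _ → ≡-from-proj₁ refl) from∘to
  where
  to : WordK degG (suc k) → MonoK degG k
  to (n ∷ w , p) = (w ·τ^ n) , trans (ℕP.+-comm _ n) (ℕP.suc-injective p)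
  from : MonoK degG k → WordK degG (suc k)
  from ((w ·τ^ n) , q) = n ∷ w , cong suc (trans (ℕP.+-comm n _) q)
  from∘to : ∀ x → from (to x) ≡ x
  from∘to (_ ∷ _ , _) = ≡-from-proj₁ refl

MonoK-G↔ : ∀ k → MonoK degG k ↔ Fin (2 ^ k)
MonoK-G↔ zero    = ↔-trans MonoK-zero↔WordK (WordK-zero↔ (λ _ → s≤s z≤n))
MonoK-G↔ (suc k) = subst (λ n → MonoK degG (suc k) ↔ Fin n)
  (cong (2 ^ k +_) (sym (ℕP.+-identityʳ (2 ^ k))))
  (↔Fin-+ (MonoK-suc↔ k) (MonoK-G↔ k) (↔-trans (WordK-G-suc↔ k) (MonoK-G↔ k)))

2^-genFunInv : GenFunInv polyG (2 ^_)
2^-genFunInv zero    = refl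
2^-genFunInv (suc k) = begin
  ℤ.+ 1 ℤ.* ℤ.+ (2 ^ suc k) ℤ.+ conv (ℤ.- ℤ.+ 2 ∷ []) (2 ^_) k
    ≡⟨ cong (λ z → ℤ.+ 1 ℤ.* ℤ.+ (2 ^ suc k) ℤ.+ z) (conv-singleton _ (2 ^_) k) ⟩
  ℤ.+ 1 ℤ.* ℤ.+ (2 ^ suc k) ℤ.+ ℤ.- ℤ.+ 2 ℤ.* ℤ.+ (2 ^ k)
    ≡⟨ -- 2 ^ suc k unfolds to 2 ^ k + (2 ^ k + 0)
       solve 1 (λ x → con (ℤ.+ 1) :* (x :+ (x :+ con (ℤ.+ 0))) :+ con (ℤ.- ℤ.+ 2) :* x := con (ℤ.+ 0))
         refl (ℤ.+ (2 ^ k)) ⟩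
  ℤ.+ 0 ∎
  where open ≡-Reasoning
        open ℤSolver.+-*-Solver

degH-pos : ∀ g → 0 < degH g
degH-pos b₁⁽¹⁾    = s≤s z≤n
degH-pos b₁⁽²⁾    = s≤s z≤n
degH-pos (b⁽¹⁾ n) = ℕP.≤-trans (s≤s z≤n) (ℕP.m≤n+m 2 n)

sgH≡neg1^ : ∀ g → sgH g ≡ neg1^ (degH g + 1)
sgH≡neg1^ b₁⁽¹⁾    = refl
sgH≡neg1^ b₁⁽²⁾    = refl
sgH≡neg1^ (b⁽¹⁾ n) = refl

-- b₁⁽²⁾ w ↦ w on the left; b_j⁽¹⁾ w ↦ w τ^(j-1) on the right, as in (I).
WordK-H-suc↔ : ∀ k → WordK degH (suc k) ↔ (WordK degH k ⊎ MonoK degH k)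
WordK-H-suc↔ k = mk↔ₛ′ to from to∘from from∘to
  where
  degH-b⁽¹⁾ : ∀ n x → degH (b⁽¹⁾ n) + x ≡ suc (x + suc n)
  degH-b⁽¹⁾ n x = trans (cong (_+ x) (ℕP.+-comm n 2)) (cong suc (ℕP.+-comm (suc n) x))
  to : WordK degH (suc k) → WordK degH k ⊎ MonoK degH k
  to (b₁⁽²⁾ ∷ w , p)  = inj₁ (w , ℕP.suc-injective p)
  to (b₁⁽¹⁾ ∷ w , p)  = inj₂ ((w ·τ^ 0) , trans (ℕP.+-identityʳ _) (ℕP.suc-injective p))
  to (b⁽¹⁾ n ∷ w , p) = inj₂ ((w ·τ^ suc n) , ℕP.suc-injective (trans (sym (degH-b⁽¹⁾ n _)) p))
  from : WordK degH k ⊎ MonoK degH k → WordK degH (suc k)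
  from (inj₁ (w , q))              = b₁⁽²⁾ ∷ w , cong suc q
  from (inj₂ ((w ·τ^ zero) , q))   = b₁⁽¹⁾ ∷ w , cong suc (trans (sym (ℕP.+-identityʳ _)) q)
  from (inj₂ ((w ·τ^ suc n) , q))  = b⁽¹⁾ n ∷ w , trans (degH-b⁽¹⁾ n _) (cong suc q)
  to∘from : ∀ x → to (from x) ≡ x
  to∘from (inj₁ _)                   = cong inj₁ (≡-from-proj₁ refl)
  to∘from (inj₂ ((_ ·τ^ zero) , _))  = cong inj₂ (≡-from-proj₁ refl)
  to∘from (inj₂ ((_ ·τ^ suc _) , _)) = cong inj₂ (≡-from-proj₁ refl)
  from∘to : ∀ x → from (to x) ≡ x
  from∘to (b₁⁽²⁾ ∷ _ , _)  = ≡-from-proj₁ refl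
  from∘to (b₁⁽¹⁾ ∷ _ , _)  = ≡-from-proj₁ refl
  from∘to (b⁽¹⁾ _ ∷ _ , _) = ≡-from-proj₁ refl

monoCountH wordCountH : ℕ → ℕ
monoCountH zero    = 1
monoCountH (suc k) = monoCountH k + wordCountH (suc k)
wordCountH zero    = 1
wordCountH (suc k) = wordCountH k + monoCountH k

MonoK-H↔ : ∀ k → MonoK degH k ↔ Fin (monoCountH k)
WordK-H↔ : ∀ k → WordK degH k ↔ Fin (wordCountH k)
MonoK-H↔ zero    = ↔-trans MonoK-zero↔WordK (WordK-zero↔ degH-pos)
MonoK-H↔ (suc k) = ↔Fin-+ (MonoK-suc↔ k) (MonoK-H↔ k) (WordK-H↔ (suc k))
WordK-H↔ zero    = WordK-zero↔ degH-pos
WordK-H↔ (suc k) = ↔Fin-+ (WordK-H-suc↔ k) (WordK-H↔ k) (MonoK-H↔ k)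

monoCountH-genFunInv : GenFunInv polyH monoCountH
monoCountH-genFunInv zero          = refl
monoCountH-genFunInv (suc zero)    = refl
monoCountH-genFunInv (suc (suc k)) = begin
  ℤ.+ 1 ℤ.* ℤ.+ monoCountH (2 + k) ℤ.+ (ℤ.- ℤ.+ 3 ℤ.* ℤ.+ monoCountH (1 + k) ℤ.+ conv (ℤ.+ 1 ∷ []) monoCountH k)
    ≡⟨ cong (λ z → ℤ.+ 1 ℤ.* ℤ.+ monoCountH (2 + k) ℤ.+ (ℤ.- ℤ.+ 3 ℤ.* ℤ.+ monoCountH (1 + k) ℤ.+ z))
            (conv-singleton _ monoCountH k) ⟩
  ℤ.+ 1 ℤ.* ℤ.+ monoCountH (2 + k) ℤ.+ (ℤ.- ℤ.+ 3 ℤ.* ℤ.+ monoCountH (1 + k) ℤ.+ ℤ.+ 1 ℤ.* ℤ.+ monoCountH k)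
    ≡⟨ -- the counts at 1 + k and 2 + k unfold to these sums of the counts at k
       solve 2 (λ a b → con (ℤ.+ 1) :* ((a :+ (b :+ a)) :+ ((b :+ a) :+ (a :+ (b :+ a))))
                        :+ (con (ℤ.- ℤ.+ 3) :* (a :+ (b :+ a)) :+ con (ℤ.+ 1) :* a) := con (ℤ.+ 0))
         refl (ℤ.+ monoCountH k) (ℤ.+ wordCountH k) ⟩
  ℤ.+ 0 ∎
  where open ≡-Reasoning
        open ℤSolver.+-*-Solver

proposition5p9 : Claim GenG degG sgG polyG × Claim GenH degH sgH polyH
proposition5p9 =
    claim-by-counting (2 ^_) (λ _ → s≤s z≤n) (λ _ → refl) 2^-genFunInv MonoK-G↔
  , claim-by-counting monoCountH degH-pos sgH≡neg1^ monoCountH-genFunInv MonoK-H↔
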